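{- Let $k$ be an integer and let $G$ be a non-complete double-critical $k$-chromatic graph. Then $G$ does not contain the complete graph $K_{k-1}$ as a subgraph.
   Context: All graphs are finite and simple. A graph $G$ is (vertex-)critical if $\chi(G-v)<\chi(G)$ for every vertex $v$. A critical graph $G$ is double-critical if $\chi(G-x-y)\le \chi(G)-2$ for every edge $xy\in E(G)$ (here $G-x-y$ denotes deletion of both end-vertices). -}

module Defs where

open import Data.Nat using (ℕ; _<_; _≤_; _+_; _∸_)
open import Data.Fin using (Fin)
open import Data.Product using (Σ; _×_; ∃-syntax)
open import Relation.Nullary using (¬_; Dec)
open import Relation.Binary.PropositionalEquality using (_≡_; _≢_)
open import Function.Definitions using (Injective)
open import Level using (0ℓ)

record Graph (n : ℕ) : Set₁ where
  field
    Adj     : Fin n → Fin n → Set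
    adj?    : ∀ x y → Dec (Adj x y)
    sym     : ∀ {x y} → Adj x y → Adj y x
    irrefl  : ∀ {x} → ¬ Adj x x

open Graph public

VSet : ℕ → Set₁
VSet n = Fin n → Set

allV : ∀ {n} → VSet n
allV _ = Data.Unit.⊤
  where import Data.Unit

minus1 : ∀ {n} → Fin n → VSet n
minus1 v x = x ≢ v

minus2 : ∀ {n} → Fin n → Fin n → VSet n
minus2 u v x = (x ≢ u) × (x ≢ v)

Colorable : ∀ {n} → Graph n → VSet n → ℕ → Set
Colorable {n} G S c =
  Σ (Fin n → Fin c) λ f →
    ∀ x y → S x → S y → Adj G x y → f x ≢ f y

ChromaticNumber : ∀ {n} → Graph n → VSet n → ℕ → Set
ChromaticNumber G S k = Colorable G S k × (∀ c → c < k → ¬ Colorable G S c)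

ChiLe : ∀ {n} → Graph n → VSet n → ℕ → Set
ChiLe G S c = Colorable G S c

KChromatic : ∀ {n} → Graph n → ℕ → Set
KChromatic G k = ChromaticNumber G allV k

Critical : ∀ {n} → Graph n → ℕ → Set
Critical {n} G k = ∀ (v : Fin n) → ∃[ c ] (c < k × ChiLe G (minus1 v) c)

DoubleCritical : ∀ {n} → Graph n → ℕ → Set
DoubleCritical {n} G k =
  Critical G k ×
  (∀ (x y : Fin n) → Adj G x y → ∃[ c ] (c + 2 ≤ k × ChiLe G (minus2 x y) c))

Complete : ∀ {n} → Graph n → Set
Complete {n} G = ∀ (x y : Fin n) → x ≢ y → Adj G x y

ContainsK : ∀ {n} → Graph n → ℕ → Set
ContainsK {n} G m =
  Σ (Fin m → Fin n) λ f → Injective _≡_ _≡_ f × (∀ i j → i ≢ j → Adj G (f i) (f j))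

module Submission where

-- Let G be k-chromatic, double-critical and non-complete, and suppose the
-- vertices h 0, …, h (k-2) form a clique K of size k-1.  We show that G is
-- complete after all.
-- For a vertex p outside K, all neighbours of p lie in K; if p missed some
-- h i, then N(p) ⊆ K - h i ⊆ N(h i) and p would be dominated.  So p sees all
-- of K, K + p is a k-clique, hence spans G, and p is adjacent to every other
-- vertex.  Together with K being a clique, any two vertices are adjacent.

open import Defs
open import Data.Nat using (ℕ; _∸_; _≤_; _<_)
open import Data.Nat.Properties using (<-≤-trans; +-comm; ∸-monoˡ-≤; m≤n+m∸n)
open import Data.Fin using (Fin; _≟_)
import Data.Fin.Properties as FinP
open import Data.Vec.Functional using (_∷_)
open import Data.Product using (∃; _,_)
open import Data.Sum using (_⊎_; inj₁; inj₂)
open import Data.Empty using (⊥-elim)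
open import Relation.Nullary using (¬_; Dec; yes; no; contradiction)
open import Relation.Binary.PropositionalEquality using (_≡_; _≢_; refl; cong; subst) renaming (sym to ≡-sym)

Clique : ∀ {n m} → Graph n → (Fin m → Fin n) → Set
Clique G h = ∀ i j → i ≢ j → Adj G (h i) (h j)

_∈Im_ : ∀ {n m} → Fin n → (Fin m → Fin n) → Set
x ∈Im h = ∃ λ i → h i ≡ x

_∈Im?_ : ∀ {n m} (x : Fin n) (h : Fin m → Fin n) → Dec (x ∈Im h)
x ∈Im? h = FinP.any? (λ i → h i ≟ x)

-- A clique of size m inside S cannot be properly coloured with fewer than m
-- colours: two clique vertices would share a colour.
cliqueBound : ∀ {n m c} (G : Graph n) (S : VSet n) (h : Fin m → Fin n) →
  Clique G h → (∀ i → S (h i)) → Colorable G S c → ¬ c < m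
cliqueBound G S h clique inS (col , proper) c<m
  with FinP.pigeonhole c<m (λ i → col (h i))
... | i , j , i<j , same =
  proper (h i) (h j) (inS i) (inS j) (clique i j (FinP.<⇒≢ i<j)) same

-- If N(p) ⊆ N(u) and u ≠ p, a colouring of G - p extends to G by giving p the
-- colour of u.
dominatedExtension : ∀ {n c} (G : Graph n) {p u : Fin n} → u ≢ p →
  (∀ y → Adj G p y → Adj G u y) → Colorable G (minus1 p) c → Colorable G allV c
dominatedExtension {n} {c} G {p} {u} u≢p dom (g , proper) = g′ , proper′
  where
  g′ : Fin n → Fin c
  g′ x with x ≟ p
  ... | yes _ = g u
  ... | no _  = g x

  -- a neighbour y of p differs from p and is adjacent to u, so g y ≢ g u
  neighbourColour : ∀ y → Adj G p y → g y ≢ g u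
  neighbourColour y a = proper y u (λ { refl → irrefl G a }) u≢p (Graph.sym G (dom y a))

  proper′ : ∀ x y → allV x → allV y → Adj G x y → g′ x ≢ g′ y
  proper′ x y _ _ a with x ≟ p | y ≟ p
  ... | yes refl | yes refl = ⊥-elim (irrefl G a)
  ... | yes refl | no _     = λ e → neighbourColour y a (≡-sym e)
  ... | no _     | yes refl = neighbourColour x (Graph.sym G a)
  ... | no x≢p   | no y≢p   = proper x y x≢p y≢p a

noDomination : ∀ {n k} (G : Graph n) → KChromatic G k → Critical G k →
  {p u : Fin n} → u ≢ p → ¬ (∀ y → Adj G p y → Adj G u y)
noDomination G (_ , minimal) critical {p} u≢p dom
  with critical p
... | c , c<k , colouring = minimal c c<k (dominatedExtension G u≢p dom colouring)

-- In a critical k-chromatic graph a clique of size at least k contains every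
-- vertex q: otherwise it lies in G - q, which has fewer than k colours.
cliqueSpans : ∀ {n k m} (G : Graph n) → Critical G k → k ≤ m →
  (h : Fin m → Fin n) → Clique G h → ∀ q → q ∈Im h
cliqueSpans G critical k≤m h clique q with q ∈Im? h
... | yes q∈h = q∈h
... | no q∉h with critical q
...   | c , c<k , colouring =
  contradiction (<-≤-trans c<k k≤m)
    (cliqueBound G (minus1 q) h clique (λ i hi≡q → q∉h (i , hi≡q)) colouring)

-- In a double-critical k-chromatic graph every edge has an end in each clique
-- of size k-1: otherwise the clique lies in G - x - y, coloured with k-2 colours.
edgeMeetsClique : ∀ {n k} (G : Graph n) → DoubleCritical G k →
  (h : Fin (k ∸ 1) → Fin n) → Clique G h →
  ∀ {x y} → Adj G x y → x ∈Im h ⊎ y ∈Im h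
edgeMeetsClique {k = k} G (_ , doubleCritical) h clique {x} {y} a
  with x ∈Im? h | y ∈Im? h
... | yes x∈h | _     = inj₁ x∈h
... | no _    | yes y∈h = inj₂ y∈h
... | no x∉h  | no y∉h with doubleCritical x y a
...   | c , c+2≤k , colouring =
  contradiction (∸-monoˡ-≤ 1 (subst (_≤ k) (+-comm c 2) c+2≤k))
    (cliqueBound G (minus2 x y) h clique
      (λ i → (λ e → x∉h (i , e)) , (λ e → y∉h (i , e))) colouring)

outsideUniversal : ∀ {n k} (G : Graph n) → KChromatic G k → DoubleCritical G k →
  (h : Fin (k ∸ 1) → Fin n) → Clique G h →
  ∀ {p} → ¬ p ∈Im h → ∀ q → q ≢ p → Adj G p q
outsideUniversal {k = k} G χG dc@(critical , _) h clique {p} p∉h q q≢p =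
  case (cliqueSpans G critical (m≤n+m∸n k 1) (p ∷ h) extendedClique q)
  where
  neighbourInK : ∀ {y} → Adj G p y → y ∈Im h
  neighbourInK a with edgeMeetsClique G dc h clique a
  ... | inj₁ p∈h = contradiction p∈h p∉h
  ... | inj₂ y∈h = y∈h

  -- if p missed h i then N(p) ⊆ K - h i ⊆ N(h i): p would be dominated
  seesK : ∀ i → Adj G p (h i)
  seesK i with adj? G p (h i)
  ... | yes a = a
  ... | no ¬a = contradiction dominated
                  (noDomination G χG critical (λ e → p∉h (i , e)))
    where
    dominated : ∀ y → Adj G p y → Adj G (h i) y
    dominated y a with neighbourInK a
    ... | j , refl = clique i j (λ { refl → ¬a a })

  extendedClique : Clique G (p ∷ h)
  extendedClique Fin.zero    Fin.zero    0≢0 = contradiction refl 0≢0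
  extendedClique Fin.zero    (Fin.suc j) _   = seesK j
  extendedClique (Fin.suc i) Fin.zero    _   = Graph.sym G (seesK i)
  extendedClique (Fin.suc i) (Fin.suc j) i≢j = clique i j (λ e → i≢j (cong Fin.suc e))

  case : q ∈Im (p ∷ h) → Adj G p q
  case (Fin.zero , refl)  = contradiction refl q≢p
  case (Fin.suc j , refl) = seesK j

proposition2 : (k n : ℕ) (G : Graph n) → KChromatic G k → DoubleCritical G k →
    ¬ Complete G → ¬ ContainsK G (k ∸ 1)
proposition2 k n G χG dc notComplete (h , _ , clique) = notComplete complete
  where
  universal : ∀ {p} → ¬ p ∈Im h → ∀ q → q ≢ p → Adj G p q
  universal = outsideUniversal G χG dc h clique

  complete : Complete G
  complete x y x≢y with x ∈Im? h | y ∈Im? h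
  ... | no x∉h       | _            = universal x∉h y (λ e → x≢y (≡-sym e))
  ... | yes _        | no y∉h       = Graph.sym G (universal y∉h x x≢y)
  ... | yes (i , refl) | yes (j , refl) = clique i j (λ { refl → x≢y refl })
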